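{- Let $\Lambda$ be a solid partition. Then $$\prod_{(i,j,k)\in\Lambda}R(i,j,k)\le\prod_{(i,j,k)\in\Lambda}R^\ast(i,j,k)\quad\text{and}\quad\prod_{(i,j,k)\in\Lambda}Q(i,j,k)\le\prod_{(i,j,k)\in\Lambda}Q^\ast(i,j,k).$$
   Context: A solid partition $\Lambda$ is a finite subset of $\mathbb Z_{\ge0}^3$ that is a lower order ideal for the componentwise order: if $(i,j,k)\in\Lambda$ and $0\le p\le i$, $0\le q\le j$, $0\le r\le k$, then $(p,q,r)\in\Lambda$. For $(i,j,k)\in\Lambda$ define $R(i,j,k)=\bigl|\{(p,j,k)\in\Lambda:i\le p\}\cup\{(i,q,k)\in\Lambda:j\le q\}\cup\{(i,j,r)\in\Lambda:k\le r\}\bigr|$, $Q(i,j,k)=\bigl|\{(p,q,k)\in\Lambda:i\le p,\ j\le q\}\cup\{(p,j,r)\in\Lambda:i\le p,\ k\le r\}\cup\{(i,q,r)\in\Lambda:j\le q,\ k\le r\}\bigr|$, $R^\ast(i,j,k)=\bigl|\{(p,j,k)\in\Lambda:p\le i\}\cup\{(i,q,k)\in\Lambda:q\le j\}\cup\{(i,j,r)\in\Lambda:r\le k\}\bigr|$, $Q^\ast(i,j,k)=\bigl|\{(p,q,k)\in\Lambda:p\le i,\ q\le j\}\cup\{(p,j,r)\in\Lambda:p\le i,\ r\le k\}\cup\{(i,q,r)\in\Lambda:q\le j,\ r\le k\}\bigr|$. -}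

module Defs where

open import Data.Nat using (ℕ; _≤_; _≟_; _≤?_)
open import Data.Product using (_×_; _,_)
open import Data.Sum using (_⊎_)
open import Data.List using (List; length; filter; map)
open import Data.Nat.ListAction using (product)
open import Data.List.Membership.Propositional using (_∈_)
open import Data.List.Relation.Unary.Unique.Propositional using (Unique)
open import Relation.Binary.PropositionalEquality using (_≡_)
open import Relation.Nullary.Decidable using (_×-dec_; _⊎-dec_)
open import Relation.Unary using (Pred; Decidable)
open import Level using (0ℓ)

Pt : Set
Pt = ℕ × ℕ × ℕ

-- A finite subset of ℤ_{≥0}^3 is given by a duplicate-free list of its elements.
-- It is a solid partition if it is a lower order ideal for the componentwise order.
record SolidPartition : Set where
  field
    elems  : List Pt
    unique : Unique elems
    lower  : ∀ {i j k p q r} → (i , j , k) ∈ elems →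
             p ≤ i → q ≤ j → r ≤ k → (p , q , r) ∈ elems
open SolidPartition public

count : (Λ : SolidPartition) {P : Pred Pt 0ℓ} → Decidable P → ℕ
count Λ P? = length (filter P? (elems Λ))

RSet : Pt → Pred Pt 0ℓ
RSet (i , j , k) (p , q , r) =
  (i ≤ p × q ≡ j × r ≡ k) ⊎ (p ≡ i × j ≤ q × r ≡ k) ⊎ (p ≡ i × q ≡ j × k ≤ r)

QSet : Pt → Pred Pt 0ℓ
QSet (i , j , k) (p , q , r) =
  (i ≤ p × j ≤ q × r ≡ k) ⊎ (i ≤ p × q ≡ j × k ≤ r) ⊎ (p ≡ i × j ≤ q × k ≤ r)

R*Set : Pt → Pred Pt 0ℓ
R*Set (i , j , k) (p , q , r) =
  (p ≤ i × q ≡ j × r ≡ k) ⊎ (p ≡ i × q ≤ j × r ≡ k) ⊎ (p ≡ i × q ≡ j × r ≤ k)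

Q*Set : Pt → Pred Pt 0ℓ
Q*Set (i , j , k) (p , q , r) =
  (p ≤ i × q ≤ j × r ≡ k) ⊎ (p ≤ i × q ≡ j × r ≤ k) ⊎ (p ≡ i × q ≤ j × r ≤ k)

RSet? : (x : Pt) → Decidable (RSet x)
RSet? (i , j , k) (p , q , r) =
  (i ≤? p ×-dec q ≟ j ×-dec r ≟ k) ⊎-dec (p ≟ i ×-dec j ≤? q ×-dec r ≟ k)
    ⊎-dec (p ≟ i ×-dec q ≟ j ×-dec k ≤? r)

QSet? : (x : Pt) → Decidable (QSet x)
QSet? (i , j , k) (p , q , r) =
  (i ≤? p ×-dec j ≤? q ×-dec r ≟ k) ⊎-dec (i ≤? p ×-dec q ≟ j ×-dec k ≤? r)
    ⊎-dec (p ≟ i ×-dec j ≤? q ×-dec k ≤? r)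

R*Set? : (x : Pt) → Decidable (R*Set x)
R*Set? (i , j , k) (p , q , r) =
  (p ≤? i ×-dec q ≟ j ×-dec r ≟ k) ⊎-dec (p ≟ i ×-dec q ≤? j ×-dec r ≟ k)
    ⊎-dec (p ≟ i ×-dec q ≟ j ×-dec r ≤? k)

Q*Set? : (x : Pt) → Decidable (Q*Set x)
Q*Set? (i , j , k) (p , q , r) =
  (p ≤? i ×-dec q ≤? j ×-dec r ≟ k) ⊎-dec (p ≤? i ×-dec q ≟ j ×-dec r ≤? k)
    ⊎-dec (p ≟ i ×-dec q ≤? j ×-dec r ≤? k)

R Q R* Q* : SolidPartition → Pt → ℕ
R  Λ x = count Λ (RSet? x)
Q  Λ x = count Λ (QSet? x)
R* Λ x = count Λ (R*Set? x)
Q* Λ x = count Λ (Q*Set? x)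

prodOver : SolidPartition → (Pt → ℕ) → ℕ
prodOver Λ f = product (map f (elems Λ))

-- For x = (i , j , k) in Λ let a₁, a₂, a₃ count the points of Λ strictly above x in the three
-- coordinate directions. As Λ is a lower set, R(x) = 1 + a₁ + a₂ + a₃ and R*(x) = 1 + i + j + k,
-- Q*(x) = 1 + (i + j + k) + (ij + ik + jk), and Q(x) ≤ 1 + (a₁ + a₂ + a₃) + (a₁a₂ + a₁a₃ + a₂a₃),
-- since a point above x in two directions has both of its projections towards x in Λ. So both
-- inequalities compare ∏ H(a₁, a₂, a₃) with ∏ H(i, j, k) for a symmetric H(a, b, c) = C(b, c) + a K(b, c)
-- with C/K nondecreasing. On a line of Λ of length T in the first direction a₁ = T - 1 - i, and pairing
-- the first with the last factor gives ∏ (Cᵢ + (T - 1 - i) Kᵢ) ≤ ∏ (Cᵢ + i Kᵢ) whenever Cᵢ/Kᵢ increases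
-- along the line; with Cᵢ = C(a₂, a₃) it does, because a₂ and a₃ decrease along the line. Sweeping the
-- three directions in turn, each time moving the next argument of H to the front by symmetry,
-- replaces a₁, a₂, a₃ by i, j, k.

module Submission where

open import Defs

open import Algebra.Bundles using (CommutativeMonoid)
open import Data.Nat using (ℕ; zero; suc; _+_; _*_; _∸_; _<_; _≤_; _≤ᵇ_; _≡ᵇ_; z≤n; s≤s)
open import Data.Nat.Properties
open import Data.Bool using (Bool; true; false; T; not; _∧_; _∨_; if_then_else_)
open import Data.Bool.Properties using (T-∧)
open import Data.Product using (_×_; _,_; ∃; proj₁; proj₂)
open import Data.Sum using (inj₁; inj₂)
open import Data.Empty using (⊥-elim)
open import Function using (_∘_)
open import Relation.Binary.PropositionalEquality as ≡ using (_≡_; _≢_; refl; cong; cong₂)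
open import Relation.Nullary using (Dec; yes; no; does)
open import Relation.Nullary.Decidable using (dec-true; dec-false)
open import Relation.Binary.Definitions using (DecidableEquality; tri<; tri≈; tri>)
open import Data.Product.Properties using (≡-dec)
open import Data.List using (List; []; _∷_; foldr; map; length; filter)
open import Data.Nat.ListAction using (sum)
open import Relation.Unary using (Pred; Decidable)
open import Level using (0ℓ)
open import Data.List.Membership.Propositional using (_∈_)
open import Data.List.Relation.Unary.Any using (here; there)
open import Data.List.Relation.Unary.All as All using ()
open import Data.List.Relation.Unary.AllPairs using (_∷_)
open import Data.List.Relation.Unary.Unique.Propositional using (Unique)
open import Data.Nat.Tactic.RingSolver using (solve-∀)
open import Function.Bundles using (module Equivalence)

open Equivalence using (to)

-- Sums and products over ranges

InBox : ℕ → Pt → Set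
InBox n (i , j , k) = i < n × j < n × k < n

_≟ₚ_ : DecidableEquality Pt
_≟ₚ_ = ≡-dec _≟_ (≡-dec _≟_ _≟_)

open import Data.List.Membership.DecPropositional _≟ₚ_ using (_∈?_)

module RangeFold {c ℓ} (CM : CommutativeMonoid c ℓ) where

  open CommutativeMonoid CM renaming (refl to ≈-refl; sym to ≈-sym; trans to ≈-trans; reflexive to ≈-reflexive)
  open import Algebra.Properties.CommutativeSemigroup commutativeSemigroup using (interchange; xy∙z≈xz∙y)
  open import Relation.Binary.Reasoning.Setoid setoid

  ⨁ : ℕ → (ℕ → Carrier) → Carrier
  ⨁ zero    f = ε
  ⨁ (suc n) f = ⨁ n f ∙ f n

  ⨁-cong : ∀ n {f g : ℕ → Carrier} → (∀ i → i < n → f i ≈ g i) → ⨁ n f ≈ ⨁ n g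
  ⨁-cong zero    f≈g = ≈-refl
  ⨁-cong (suc n) f≈g = ∙-cong (⨁-cong n λ i i<n → f≈g i (m≤n⇒m≤1+n i<n)) (f≈g n ≤-refl)

  ⨁-identity : ∀ n {f : ℕ → Carrier} → (∀ i → i < n → f i ≈ ε) → ⨁ n f ≈ ε
  ⨁-identity zero    f≈ε = ≈-refl
  ⨁-identity (suc n) f≈ε = begin
    ⨁ n _ ∙ _ ≈⟨ ∙-cong (⨁-identity n λ i i<n → f≈ε i (m≤n⇒m≤1+n i<n)) (f≈ε n ≤-refl) ⟩
    ε ∙ ε     ≈⟨ identityˡ ε ⟩
    ε         ∎

  ⨁-distrib : ∀ n (f g : ℕ → Carrier) → ⨁ n (λ i → f i ∙ g i) ≈ ⨁ n f ∙ ⨁ n g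
  ⨁-distrib zero    f g = ≈-sym (identityˡ ε)
  ⨁-distrib (suc n) f g = begin
    ⨁ n (λ i → f i ∙ g i) ∙ (f n ∙ g n)  ≈⟨ ∙-congʳ (⨁-distrib n f g) ⟩
    (⨁ n f ∙ ⨁ n g) ∙ (f n ∙ g n)        ≈⟨ interchange _ _ _ _ ⟩
    (⨁ n f ∙ f n) ∙ (⨁ n g ∙ g n)        ∎

  ⨁-comm : ∀ m n (h : ℕ → ℕ → Carrier) → ⨁ m (λ a → ⨁ n (h a)) ≈ ⨁ n (λ b → ⨁ m (λ a → h a b))
  ⨁-comm zero    n h = ≈-sym (⨁-identity n λ _ _ → ≈-refl)
  ⨁-comm (suc m) n h = begin
    ⨁ m (λ a → ⨁ n (h a)) ∙ ⨁ n (h m)          ≈⟨ ∙-congʳ (⨁-comm m n h) ⟩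
    ⨁ n (λ b → ⨁ m (λ a → h a b)) ∙ ⨁ n (h m)  ≈⟨ ≈-sym (⨁-distrib n _ (h m)) ⟩
    ⨁ n (λ b → ⨁ m (λ a → h a b) ∙ h m b)      ∎

  ⨁-first : ∀ n (f : ℕ → Carrier) → ⨁ (suc n) f ≈ f 0 ∙ ⨁ n (f ∘ suc)
  ⨁-first zero    f = ≈-trans (identityˡ (f 0)) (≈-sym (identityʳ (f 0)))
  ⨁-first (suc n) f = ≈-trans (∙-congʳ (⨁-first n f)) (assoc (f 0) _ _)

  ⨁-ends : ∀ n (f : ℕ → Carrier) → ⨁ (suc (suc n)) f ≈ (f 0 ∙ f (suc n)) ∙ ⨁ n (f ∘ suc)
  ⨁-ends n f = begin
    ⨁ (suc n) f ∙ f (suc n)          ≈⟨ ∙-congʳ (⨁-first n f) ⟩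
    f 0 ∙ ⨁ n (f ∘ suc) ∙ f (suc n)  ≈⟨ xy∙z≈xz∙y (f 0) _ _ ⟩
    f 0 ∙ f (suc n) ∙ ⨁ n (f ∘ suc)  ∎

  ⨁-prefix : ∀ {m} n {f : ℕ → Carrier} → m ≤ n → (∀ i → m ≤ i → i < n → f i ≈ ε) → ⨁ n f ≈ ⨁ m f
  ⨁-prefix n m≤n f≈ε with m≤n⇒m<n∨m≡n m≤n
  ... | inj₂ ≡.refl = ≈-refl
  ⨁-prefix {m} (suc n) {f} m≤n f≈ε | inj₁ m<1+n = begin
    ⨁ n f ∙ f n  ≈⟨ ∙-cong (⨁-prefix n (≤-pred m<1+n) λ i m≤i i<n → f≈ε i m≤i (m≤n⇒m≤1+n i<n))
                           (f≈ε n (≤-pred m<1+n) ≤-refl) ⟩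
    ⨁ m f ∙ ε    ≈⟨ identityʳ _ ⟩
    ⨁ m f        ∎

  ⨁-single : ∀ n {a} {f : ℕ → Carrier} → a < n → (∀ i → i < n → i ≢ a → f i ≈ ε) → ⨁ n f ≈ f a
  ⨁-single (suc n) {a} {f} a<1+n f≈ε with m≤n⇒m<n∨m≡n (≤-pred a<1+n)
  ... | inj₁ a<n = begin
    ⨁ n f ∙ f n  ≈⟨ ∙-cong (⨁-single n a<n λ i i<n → f≈ε i (m≤n⇒m≤1+n i<n))
                           (f≈ε n ≤-refl λ n≡a → <-irrefl (≡.sym n≡a) a<n) ⟩
    f a ∙ ε      ≈⟨ identityʳ (f a) ⟩
    f a          ∎
  ... | inj₂ ≡.refl = begin
    ⨁ n f ∙ f n  ≈⟨ ∙-congʳ (⨁-identity n λ i i<n → f≈ε i (m≤n⇒m≤1+n i<n) (<⇒≢ i<n)) ⟩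
    ε ∙ f n      ≈⟨ identityˡ (f n) ⟩
    f n          ∎

  ⨁-restrict : ∀ n {T} {m : ℕ → Bool} (f : ℕ → Carrier) → T ≤ n → (∀ a → m a ≡ true → a < T) →
    (∀ a → a < T → m a ≡ true) → ⨁ n (λ i → if m i then f i else ε) ≈ ⨁ T f
  ⨁-restrict n {T} {m} f T≤n m⇒<T <T⇒m = begin
    ⨁ n (λ i → if m i then f i else ε)  ≈⟨ ⨁-prefix n T≤n outside ⟩
    ⨁ T (λ i → if m i then f i else ε)  ≈⟨ ⨁-cong T inside ⟩
    ⨁ T f                               ∎
    where
    outside : ∀ i → T ≤ i → i < n → (if m i then f i else ε) ≈ ε
    outside i T≤i _ with m i in mi
    ... | true  = ⊥-elim (<⇒≱ (m⇒<T i mi) T≤i)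
    ... | false = ≈-refl
    inside : ∀ i → i < T → (if m i then f i else ε) ≈ f i
    inside i i<T rewrite <T⇒m i i<T = ≈-refl

  ⨁³ : ℕ → (ℕ → ℕ → ℕ → Carrier) → Carrier
  ⨁³ n g = ⨁ n λ r → ⨁ n λ q → ⨁ n λ p → g p q r

  ⨁³-cong : ∀ n {g h : ℕ → ℕ → ℕ → Carrier} → (∀ p q r → g p q r ≈ h p q r) → ⨁³ n g ≈ ⨁³ n h
  ⨁³-cong n g≈h = ⨁-cong n λ r _ → ⨁-cong n λ q _ → ⨁-cong n λ p _ → g≈h p q r

  ⨁³-distrib : ∀ n (g h : ℕ → ℕ → ℕ → Carrier) → ⨁³ n (λ p q r → g p q r ∙ h p q r) ≈ ⨁³ n g ∙ ⨁³ n h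
  ⨁³-distrib n g h = ≈-trans (⨁-cong n λ r _ → ≈-trans (⨁-cong n λ q _ → ⨁-distrib n (λ p → g p q r) (λ p → h p q r))
                                                       (⨁-distrib n _ _))
                             (⨁-distrib n _ _)

  ⨁³-identity : ∀ n {g : ℕ → ℕ → ℕ → Carrier} → (∀ p q r → g p q r ≈ ε) → ⨁³ n g ≈ ε
  ⨁³-identity n g≈ε = ⨁-identity n λ r _ → ⨁-identity n λ q _ → ⨁-identity n λ p _ → g≈ε p q r

  ⨁³-single : ∀ n {i j k} {g : ℕ → ℕ → ℕ → Carrier} → i < n → j < n → k < n →
    (∀ p q r → (p , q , r) ≢ (i , j , k) → g p q r ≈ ε) → ⨁³ n g ≈ g i j k
  ⨁³-single n {i} {j} {k} {g} i<n j<n k<n g≈ε = begin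
    ⨁³ n g                            ≈⟨ ⨁-single n k<n (λ r _ r≢k → ⨁-identity n λ q _ → ⨁-identity n λ p _ →
                                                           g≈ε p q r (r≢k ∘ cong (proj₂ ∘ proj₂))) ⟩
    ⨁ n (λ q → ⨁ n λ p → g p q k)     ≈⟨ ⨁-single n j<n (λ q _ q≢j → ⨁-identity n λ p _ →
                                                           g≈ε p q k (q≢j ∘ cong (proj₁ ∘ proj₂))) ⟩
    ⨁ n (λ p → g p j k)               ≈⟨ ⨁-single n i<n (λ p _ p≢i → g≈ε p j k (p≢i ∘ cong proj₁)) ⟩
    g i j k                           ∎

  ⨁-over-list : ∀ n {xs} → Unique xs → (∀ {x} → x ∈ xs → InBox n x) → (f : Pt → Carrier) →
    foldr _∙_ ε (map f xs) ≈ ⨁³ n (λ p q r → if does ((p , q , r) ∈? xs) then f (p , q , r) else ε)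
  ⨁-over-list n {[]}     _                 _     f = ≈-sym (⨁³-identity n λ _ _ _ → ≈-refl)
  ⨁-over-list n {x@(_ , _ , _) ∷ xs} (x∉xs ∷ unique) inBox f = begin
    f x ∙ foldr _∙_ ε (map f xs)
      ≈⟨ ∙-cong (≈-sym only-x) (⨁-over-list n unique (inBox ∘ there) f) ⟩
    ⨁³ n (λ p q r → at-x (p , q , r)) ∙ ⨁³ n (λ p q r → in-xs (p , q , r))
      ≈⟨ ≈-sym (⨁³-distrib n _ _) ⟩
    ⨁³ n (λ p q r → at-x (p , q , r) ∙ in-xs (p , q , r))
      ≈⟨ ⨁³-cong n (λ p q r → split (p , q , r)) ⟩
    ⨁³ n (λ p q r → if does ((p , q , r) ∈? x ∷ xs) then f (p , q , r) else ε) ∎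
    where
    at-x in-xs : Pt → Carrier
    at-x  y = if does (y ≟ₚ x) then f y else ε
    in-xs y = if does (y ∈? xs) then f y else ε
    only-x : ⨁³ n (λ p q r → at-x (p , q , r)) ≈ f x
    only-x with inBox (here ≡.refl)
    ... | i<n , j<n , k<n = ≈-trans
      (⨁³-single n i<n j<n k<n λ p q r y≢x →
         ≈-reflexive (cong (if_then f (p , q , r) else ε) (dec-false (_ ≟ₚ _) y≢x)))
      (≈-reflexive (cong (if_then f x else ε) (dec-true (x ≟ₚ x) ≡.refl)))
    split : ∀ y → at-x y ∙ in-xs y ≈ (if does (y ∈? x ∷ xs) then f y else ε)
    split y with y ≟ₚ x | y ∈? xs
    ... | yes ≡.refl | yes y∈xs = ⊥-elim (All.lookup x∉xs y∈xs ≡.refl)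
    ... | yes ≡.refl | no  _    = identityʳ (f y)
    ... | no  _      | yes _    = identityˡ (f y)
    ... | no  _      | no  _    = identityˡ ε

open RangeFold +-0-commutativeMonoid public using () renaming
  ( ⨁ to ∑ ; ⨁-cong to ∑-cong ; ⨁-prefix to ∑-prefix ; ⨁-single to ∑-single ; ⨁-restrict to ∑-restrict
  ; ⨁³ to ∑³ ; ⨁³-cong to ∑³-cong ; ⨁³-distrib to ∑³-distrib ; ⨁-over-list to ∑-over-list )
open RangeFold *-1-commutativeMonoid public using () renaming
  ( ⨁ to ∏ ; ⨁-cong to ∏-cong ; ⨁-comm to ∏-comm ; ⨁-ends to ∏-ends ; ⨁-restrict to ∏-restrict
  ; ⨁³ to ∏³ ; ⨁³-cong to ∏³-cong ; ⨁-over-list to ∏-over-list )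

∑-mono-≤ : ∀ n {f g : ℕ → ℕ} → (∀ i → i < n → f i ≤ g i) → ∑ n f ≤ ∑ n g
∑-mono-≤ zero    f≤g = z≤n
∑-mono-≤ (suc n) f≤g = +-mono-≤ (∑-mono-≤ n λ i i<n → f≤g i (m≤n⇒m≤1+n i<n)) (f≤g n ≤-refl)

∏-mono-≤ : ∀ n {f g : ℕ → ℕ} → (∀ i → i < n → f i ≤ g i) → ∏ n f ≤ ∏ n g
∏-mono-≤ zero    f≤g = ≤-refl
∏-mono-≤ (suc n) f≤g = *-mono-≤ (∏-mono-≤ n λ i i<n → f≤g i (m≤n⇒m≤1+n i<n)) (f≤g n ≤-refl)

∑-*ˡ : ∀ n a (f : ℕ → ℕ) → ∑ n (λ i → a * f i) ≡ a * ∑ n f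
∑-*ˡ zero    a f = ≡.sym (*-zeroʳ a)
∑-*ˡ (suc n) a f = ≡.trans (cong (_+ a * f n) (∑-*ˡ n a f)) (≡.sym (*-distribˡ-+ a (∑ n f) (f n)))

∑-outer-product : ∀ m n (f g : ℕ → ℕ) → ∑ n (λ b → ∑ m (λ a → f a * g b)) ≡ ∑ m f * ∑ n g
∑-outer-product m n f g = begin
  ∑ n (λ b → ∑ m (λ a → f a * g b))  ≡⟨ ∑-cong n (λ b _ → ≡.trans (∑-cong m λ a _ → *-comm (f a) (g b))
                                                                  (∑-*ˡ m (g b) f)) ⟩
  ∑ n (λ b → g b * ∑ m f)            ≡⟨ ∑-cong n (λ b _ → *-comm (g b) (∑ m f)) ⟩
  ∑ n (λ b → ∑ m f * g b)            ≡⟨ ∑-*ˡ n (∑ m f) g ⟩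
  ∑ m f * ∑ n g                      ∎
  where open ≡.≡-Reasoning

data Side : Set where
  below level above : Side

side : ℕ → ℕ → Side
side zero    zero    = level
side zero    (suc _) = below
side (suc _) zero    = above
side (suc p) (suc i) = side p i

side-< : ∀ {p i} → p < i → side p i ≡ below
side-< {zero}  {suc i} _         = refl
side-< {suc p} {suc i} (s≤s p<i) = side-< p<i

side-≡ : ∀ p → side p p ≡ level
side-≡ zero    = refl
side-≡ (suc p) = side-≡ p

side-> : ∀ {p i} → i < p → side p i ≡ above
side-> {suc p} {zero}  _         = refl
side-> {suc p} {suc i} (s≤s i<p) = side-> i<p

side≡below⇒< : ∀ {p i} → side p i ≡ below → p < i
side≡below⇒< {zero}  {suc i} _  = s≤s z≤n
side≡below⇒< {suc p} {suc i} eq = s≤s (side≡below⇒< eq)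

side≡above⇒> : ∀ {p i} → side p i ≡ above → i < p
side≡above⇒> {suc p} {zero}  _  = s≤s z≤n
side≡above⇒> {suc p} {suc i} eq = s≤s (side≡above⇒> eq)

is : Side → Side → Bool
is below below = true
is level level = true
is above above = true
is _     _     = false

⟦_⟧ : Bool → ℕ
⟦ b ⟧ = if b then 1 else 0

⟦⟧-* : ∀ b x → ⟦ b ⟧ * x ≡ (if b then x else 0)
⟦⟧-* true  x = +-identityʳ x
⟦⟧-* false x = refl

⟦⟧-mono : ∀ {b b′} → (b ≡ true → b′ ≡ true) → ⟦ b ⟧ ≤ ⟦ b′ ⟧
⟦⟧-mono {false} _   = z≤n
⟦⟧-mono {true}  b⇒b′ rewrite b⇒b′ refl = ≤-refl

χ : Side → Side → ℕ
χ t s = ⟦ is t s ⟧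

χ-level-≢ : ∀ {p i} → p ≢ i → χ level (side p i) ≡ 0
χ-level-≢ {p} {i} p≢i with <-cmp p i
... | tri< p<i _ _ rewrite side-< p<i = refl
... | tri≈ _ p≡i _ = ⊥-elim (p≢i p≡i)
... | tri> _ _ i<p rewrite side-> i<p = refl

∑-above : ∀ T i → ∑ T (λ p → χ above (side p i)) ≡ T ∸ suc i
∑-above zero    i = refl
∑-above (suc T) i with <-cmp T i
... | tri< T<i _ _ rewrite ∑-above T i | side-< T<i | m≤n⇒m∸n≡0 (<⇒≤ T<i) | m≤n⇒m∸n≡0 (m<n⇒m≤1+n T<i) = refl
... | tri≈ _ refl _ rewrite ∑-above T T | side-≡ T | n∸n≡0 T | m≤n⇒m∸n≡0 (n≤1+n T) = refl
... | tri> _ _ i<T rewrite ∑-above T i | side-> i<T = ≡.trans (+-comm (T ∸ suc i) 1) (≡.sym (+-∸-assoc 1 i<T))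

∑-below : ∀ T i → i ≤ T → ∑ T (λ p → χ below (side p i)) ≡ i
∑-below T i i≤T = ≡.trans (∑-prefix T i≤T vanish) (all-below i ≤-refl)
  where
  vanish : ∀ p → i ≤ p → p < T → χ below (side p i) ≡ 0
  vanish p i≤p _ with m≤n⇒m<n∨m≡n i≤p
  ... | inj₁ i<p  rewrite side-> i<p = refl
  ... | inj₂ refl rewrite side-≡ i   = refl
  all-below : ∀ t → t ≤ i → ∑ t (λ p → χ below (side p i)) ≡ t
  all-below zero    _   = refl
  all-below (suc t) t<i rewrite all-below t (<⇒≤ t<i) | side-< t<i = +-comm t 1

∑-pick : ∀ n {i} (f : ℕ → ℕ) → i < n → ∑ n (λ p → χ level (side p i) * f p) ≡ f i
∑-pick n {i} f i<n = begin
  ∑ n (λ p → χ level (side p i) * f p)  ≡⟨ ∑-single n i<n (λ p _ p≢i → cong (_* f p) (χ-level-≢ p≢i)) ⟩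
  χ level (side i i) * f i              ≡⟨ cong (λ s → χ level s * f i) (side-≡ i) ⟩
  1 * f i                               ≡⟨ *-identityˡ (f i) ⟩
  f i                                   ∎
  where open ≡.≡-Reasoning

∑-pick-outer : ∀ n {j} (G : ℕ → ℕ → ℕ) → j < n →
  ∑ n (λ q → ∑ n (λ p → χ level (side q j) * G p q)) ≡ ∑ n (λ p → G p j)
∑-pick-outer n {j} G j<n =
  ≡.trans (∑-cong n λ q _ → ∑-*ˡ n (χ level (side q j)) (λ p → G p q)) (∑-pick n (λ q → ∑ n λ p → G p q) j<n)

module _ (n : ℕ) {i j k : ℕ} (i<n : i < n) (j<n : j < n) (k<n : k < n) where

  ∑³-pick₁ : (F : ℕ → ℕ → ℕ → ℕ) →
    ∑³ n (λ p q r → χ level (side p i) * F p q r) ≡ ∑ n λ r → ∑ n λ q → F i q r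
  ∑³-pick₁ F = ∑-cong n λ r _ → ∑-cong n λ q _ → ∑-pick n (λ p → F p q r) i<n

  ∑³-pick₂ : (F : ℕ → ℕ → ℕ → ℕ) →
    ∑³ n (λ p q r → χ level (side q j) * F p q r) ≡ ∑ n λ r → ∑ n λ p → F p j r
  ∑³-pick₂ F = ∑-cong n λ r _ → ∑-pick-outer n (λ p q → F p q r) j<n

  ∑³-pick₃ : (F : ℕ → ℕ → ℕ → ℕ) →
    ∑³ n (λ p q r → χ level (side r k) * F p q r) ≡ ∑ n λ q → ∑ n λ p → F p q k
  ∑³-pick₃ F = ≡.trans (∑-cong n λ r _ → ≡.trans (∑-cong n λ q _ → ∑-*ˡ n (χ level (side r k)) (λ p → F p q r))
                                                 (∑-*ˡ n (χ level (side r k)) (λ q → ∑ n λ p → F p q r)))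
                       (∑-pick n (λ r → ∑ n λ q → ∑ n λ p → F p q r) k<n)

  ∑³-pick₁₂ : (F : ℕ → ℕ → ℕ → ℕ) →
    ∑³ n (λ p q r → χ level (side p i) * (χ level (side q j) * F p q r)) ≡ ∑ n λ r → F i j r
  ∑³-pick₁₂ F = ≡.trans (∑³-pick₁ λ p q r → χ level (side q j) * F p q r)
                        (∑-cong n λ r _ → ∑-pick n (λ q → F i q r) j<n)

  ∑³-pick₁₃ : (F : ℕ → ℕ → ℕ → ℕ) →
    ∑³ n (λ p q r → χ level (side p i) * (χ level (side r k) * F p q r)) ≡ ∑ n λ q → F i q k
  ∑³-pick₁₃ F = ≡.trans (∑³-pick₁ λ p q r → χ level (side r k) * F p q r)
                        (∑-pick-outer n (λ q r → F i q r) k<n)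

  ∑³-pick₂₃ : (F : ℕ → ℕ → ℕ → ℕ) →
    ∑³ n (λ p q r → χ level (side q j) * (χ level (side r k) * F p q r)) ≡ ∑ n λ p → F p j k
  ∑³-pick₂₃ F = ≡.trans (∑³-pick₂ λ p q r → χ level (side r k) * F p q r)
                        (∑-pick-outer n (λ p r → F p j r) k<n)

-- Cell decomposition of the sets defining R, Q, R*, Q*

atLeast atMost : Side → Bool
atLeast s = not (is below s)
atMost  s = not (is above s)

≡ᵇ-side : ∀ p i → (p ≡ᵇ i) ≡ is level (side p i)
≡ᵇ-side zero    zero    = refl
≡ᵇ-side zero    (suc i) = refl
≡ᵇ-side (suc p) zero    = refl
≡ᵇ-side (suc p) (suc i) = ≡ᵇ-side p i

≤ᵇ-side : ∀ p i → (p ≤ᵇ i) ≡ atMost (side p i)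
≤ᵇ-side zero          zero    = refl
≤ᵇ-side zero          (suc i) = refl
≤ᵇ-side (suc p)       zero    = refl
≤ᵇ-side (suc zero)    (suc i) = ≤ᵇ-side zero i
≤ᵇ-side (suc (suc p)) (suc i) = ≤ᵇ-side (suc p) i

≥ᵇ-side : ∀ p i → (i ≤ᵇ p) ≡ atLeast (side p i)
≥ᵇ-side zero    zero          = refl
≥ᵇ-side zero    (suc i)       = refl
≥ᵇ-side (suc p) zero          = refl
≥ᵇ-side (suc p) (suc zero)    = ≥ᵇ-side p zero
≥ᵇ-side (suc p) (suc (suc i)) = ≥ᵇ-side p (suc i)

every : (Side → Bool) → Bool
every f = f below ∧ f level ∧ f above

every-sound : ∀ f → T (every f) → ∀ s → T (f s)
every-sound f h below = proj₁ (to (T-∧ {f below}) h)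
every-sound f h level = proj₁ (to (T-∧ {f level}) (proj₂ (to (T-∧ {f below}) h)))
every-sound f h above = proj₂ (to (T-∧ {f level}) (proj₂ (to (T-∧ {f below}) h)))

by-truth-table : {f g : Side → Side → Side → ℕ} →
  T (every λ a → every λ b → every λ c → f a b c ≡ᵇ g a b c) → ∀ a b c → f a b c ≡ g a b c
by-truth-table {f} {g} h a b c =
  ≡ᵇ⇒≡ _ _ (every-sound (λ c → f a b c ≡ᵇ g a b c)
             (every-sound (λ b → every λ c → f a b c ≡ᵇ g a b c)
               (every-sound (λ a → every λ b → every λ c → f a b c ≡ᵇ g a b c) h a) b) c)

-- The indicators of the sets defining R, R*, Q, Q* at x are sums of products of cell indicators around x:
-- the cells reached from x by moving towards t in at most one (oneStep t) or two (twoStep t) directions.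
oneStep twoStep : Side → Side → Side → Side → ℕ
oneStep t a b c = χ level a * χ level b * χ level c + χ t a * χ level b * χ level c
                + χ level a * χ t b * χ level c + χ level a * χ level b * χ t c
twoStep t a b c = oneStep t a b c + χ t a * χ t b * χ level c
                + χ t a * χ level b * χ t c + χ level a * χ t b * χ t c

RSet-cells : ∀ i j k p q r → ⟦ does (RSet? (i , j , k) (p , q , r)) ⟧ ≡ oneStep above (side p i) (side q j) (side r k)
RSet-cells i j k p q r rewrite ≥ᵇ-side p i | ≡ᵇ-side q j | ≡ᵇ-side r k | ≡ᵇ-side p i | ≥ᵇ-side q j | ≥ᵇ-side r k =
  table (side p i) (side q j) (side r k)
  where
  table : ∀ a b c → ⟦ (atLeast a ∧ is level b ∧ is level c) ∨ (is level a ∧ atLeast b ∧ is level c)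
                      ∨ (is level a ∧ is level b ∧ atLeast c) ⟧ ≡ oneStep above a b c
  table = by-truth-table _

R*Set-cells : ∀ i j k p q r → ⟦ does (R*Set? (i , j , k) (p , q , r)) ⟧ ≡ oneStep below (side p i) (side q j) (side r k)
R*Set-cells i j k p q r rewrite ≤ᵇ-side p i | ≡ᵇ-side q j | ≡ᵇ-side r k | ≡ᵇ-side p i | ≤ᵇ-side q j | ≤ᵇ-side r k =
  table (side p i) (side q j) (side r k)
  where
  table : ∀ a b c → ⟦ (atMost a ∧ is level b ∧ is level c) ∨ (is level a ∧ atMost b ∧ is level c)
                      ∨ (is level a ∧ is level b ∧ atMost c) ⟧ ≡ oneStep below a b c
  table = by-truth-table _

QSet-cells : ∀ i j k p q r → ⟦ does (QSet? (i , j , k) (p , q , r)) ⟧ ≡ twoStep above (side p i) (side q j) (side r k)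
QSet-cells i j k p q r rewrite ≥ᵇ-side p i | ≥ᵇ-side q j | ≡ᵇ-side r k | ≡ᵇ-side q j | ≥ᵇ-side r k | ≡ᵇ-side p i =
  table (side p i) (side q j) (side r k)
  where
  table : ∀ a b c → ⟦ (atLeast a ∧ atLeast b ∧ is level c) ∨ (atLeast a ∧ is level b ∧ atLeast c)
                      ∨ (is level a ∧ atLeast b ∧ atLeast c) ⟧ ≡ twoStep above a b c
  table = by-truth-table _

Q*Set-cells : ∀ i j k p q r → ⟦ does (Q*Set? (i , j , k) (p , q , r)) ⟧ ≡ twoStep below (side p i) (side q j) (side r k)
Q*Set-cells i j k p q r rewrite ≤ᵇ-side p i | ≤ᵇ-side q j | ≡ᵇ-side r k | ≡ᵇ-side q j | ≤ᵇ-side r k | ≡ᵇ-side p i =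
  table (side p i) (side q j) (side r k)
  where
  table : ∀ a b c → ⟦ (atMost a ∧ atMost b ∧ is level c) ∨ (atMost a ∧ is level b ∧ atMost c)
                      ∨ (is level a ∧ atMost b ∧ atMost c) ⟧ ≡ twoStep below a b c
  table = by-truth-table _

DownClosed : (ℕ → Bool) → Set
DownClosed m = ∀ {a b} → a ≤ b → m b ≡ true → m a ≡ true

BoundedBy : ℕ → (ℕ → Bool) → Set
BoundedBy n m = ∀ a → m a ≡ true → a < n

IsPrefix : (ℕ → Bool) → ℕ → Set
IsPrefix m T = (∀ a → m a ≡ true → a < T) × (∀ a → a < T → m a ≡ true)

downClosed⇒prefix : ∀ n {m} → DownClosed m → BoundedBy n m → ∃ λ T → T ≤ n × IsPrefix m T
downClosed⇒prefix zero    {m} _     bounded = 0 , z≤n , bounded , λ _ ()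
downClosed⇒prefix (suc n) {m} lower bounded with m n in mn
... | true  = suc n , ≤-refl , bounded , λ a a<1+n → lower (≤-pred a<1+n) mn
... | false with downClosed⇒prefix n lower bounded′
  where
  bounded′ : BoundedBy n m
  bounded′ a ma with m≤n⇒m<n∨m≡n (≤-pred (bounded a ma))
  ... | inj₁ a<n  = a<n
  ... | inj₂ refl with ≡.trans (≡.sym ma) mn
  ... | ()
... | T , T≤n , prefix = T , m≤n⇒m≤1+n T≤n , prefix

∑-below-within : ∀ n {m i} → DownClosed m → m i ≡ true → i ≤ n →
  ∑ n (λ p → ⟦ m p ⟧ * χ below (side p i)) ≡ i
∑-below-within n {m} {i} lower mi i≤n = ≡.trans (∑-cong n λ p _ → drop-⟦⟧ p) (∑-below n i i≤n)
  where
  drop-⟦⟧ : ∀ p → ⟦ m p ⟧ * χ below (side p i) ≡ χ below (side p i)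
  drop-⟦⟧ p with side p i in sp
  ... | below = cong (λ b → ⟦ b ⟧ * 1) (lower (<⇒≤ (side≡below⇒< sp)) mi)
  ... | level = *-zeroʳ ⟦ m p ⟧
  ... | above = *-zeroʳ ⟦ m p ⟧

DownClosed₂ : (ℕ → ℕ → Bool) → Set
DownClosed₂ N = ∀ {a b a′ b′} → a′ ≤ a → b′ ≤ b → N a b ≡ true → N a′ b′ ≡ true

∑²-below-within : ∀ n {N i j} → DownClosed₂ N → N i j ≡ true → i ≤ n → j ≤ n →
  ∑ n (λ b → ∑ n (λ a → ⟦ N a b ⟧ * (χ below (side a i) * χ below (side b j)))) ≡ i * j
∑²-below-within n {N} {i} {j} lower Nij i≤n j≤n = begin
  ∑ n (λ b → ∑ n (λ a → ⟦ N a b ⟧ * (χ below (side a i) * χ below (side b j))))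
    ≡⟨ ∑-cong n (λ b _ → ∑-cong n λ a _ → drop-⟦⟧ a b) ⟩
  ∑ n (λ b → ∑ n (λ a → χ below (side a i) * χ below (side b j)))
    ≡⟨ ∑-outer-product n n _ _ ⟩
  ∑ n (λ a → χ below (side a i)) * ∑ n (λ b → χ below (side b j))
    ≡⟨ cong₂ _*_ (∑-below n i i≤n) (∑-below n j j≤n) ⟩
  i * j ∎
  where
  open ≡.≡-Reasoning
  drop-⟦⟧ : ∀ a b → ⟦ N a b ⟧ * (χ below (side a i) * χ below (side b j)) ≡ χ below (side a i) * χ below (side b j)
  drop-⟦⟧ a b with side a i in sa | side b j in sb
  ... | below | below = cong (λ b → ⟦ b ⟧ * 1) (lower (<⇒≤ (side≡below⇒< sa)) (<⇒≤ (side≡below⇒< sb)) Nij)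
  ... | below | level = *-zeroʳ ⟦ N a b ⟧
  ... | below | above = *-zeroʳ ⟦ N a b ⟧
  ... | level | _     = *-zeroʳ ⟦ N a b ⟧
  ... | above | _     = *-zeroʳ ⟦ N a b ⟧

∑²-above-≤ : ∀ n {N} i j → DownClosed₂ N →
  ∑ n (λ b → ∑ n (λ a → ⟦ N a b ⟧ * (χ above (side a i) * χ above (side b j))))
    ≤ ∑ n (λ a → ⟦ N a j ⟧ * χ above (side a i)) * ∑ n (λ b → ⟦ N i b ⟧ * χ above (side b j))
∑²-above-≤ n {N} i j lower = ≤-trans (∑-mono-≤ n λ b _ → ∑-mono-≤ n λ a _ → split a b)
  (≤-reflexive (∑-outer-product n n (λ a → ⟦ N a j ⟧ * χ above (side a i)) (λ b → ⟦ N i b ⟧ * χ above (side b j))))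
  where
  split : ∀ a b → ⟦ N a b ⟧ * (χ above (side a i) * χ above (side b j))
                    ≤ ⟦ N a j ⟧ * χ above (side a i) * (⟦ N i b ⟧ * χ above (side b j))
  split a b with side a i in sa | side b j in sb
  ... | above | above with N a b in Nab
  ...   | false = z≤n
  ...   | true rewrite lower ≤-refl (<⇒≤ (side≡above⇒> sb)) Nab
                    | lower (<⇒≤ (side≡above⇒> sa)) ≤-refl Nab = ≤-refl
  split a b | above | below rewrite *-zeroʳ ⟦ N a b ⟧ = z≤n
  split a b | above | level rewrite *-zeroʳ ⟦ N a b ⟧ = z≤n
  split a b | below | _     rewrite *-zeroʳ ⟦ N a b ⟧ = z≤n
  split a b | level | _     rewrite *-zeroʳ ⟦ N a b ⟧ = z≤n

-- The rearrangement inequality along one line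

-- With A = B + D, the right-hand side exceeds the left-hand side by D (c k′ - k c′).
exchange-≤ : ∀ c c′ k k′ {A B} → B ≤ A → k * c′ ≤ c * k′ →
  (c + A * k) * (c′ + B * k′) ≤ (c + B * k) * (c′ + A * k′)
exchange-≤ c c′ k k′ {B = B} B≤A kc′≤ck′ with m≤n⇒∃[o]m+o≡n B≤A
... | D , refl = begin
  (c + (B + D) * k) * (c′ + B * k′)  ≡⟨ expandˡ c c′ k k′ B D ⟩
  base + D * (k * c′)                ≤⟨ +-monoʳ-≤ base (*-monoʳ-≤ D kc′≤ck′) ⟩
  base + D * (c * k′)                ≡⟨ expandʳ c c′ k k′ B D ⟩
  (c + B * k) * (c′ + (B + D) * k′)  ∎
  where
  open ≤-Reasoning
  base = (c + B * k) * (c′ + B * k′) + D * B * k * k′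
  expandˡ : ∀ c c′ k k′ B D →
    (c + (B + D) * k) * (c′ + B * k′) ≡ (c + B * k) * (c′ + B * k′) + D * B * k * k′ + D * (k * c′)
  expandˡ = solve-∀
  expandʳ : ∀ c c′ k k′ B D →
    (c + B * k) * (c′ + B * k′) + D * B * k * k′ + D * (c * k′) ≡ (c + B * k) * (c′ + (B + D) * k′)
  expandʳ = solve-∀

-- The first and last factors are exchanged by exchange-≤; the inner factors form an instance with offset s + 1.
rearrangement : ∀ L s (C K : ℕ → ℕ) → (∀ {a b} → a ≤ b → b < L → K a * C b ≤ C a * K b) →
  ∏ L (λ t → C t + (s + (L ∸ suc t)) * K t) ≤ ∏ L (λ t → C t + (s + t) * K t)
rearrangement zero          s C K _     = ≤-refl
rearrangement (suc zero)    s C K _     = ≤-refl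
rearrangement (suc (suc L)) s C K cross = begin
  ∏ (suc (suc L)) f                ≡⟨ ∏-ends L f ⟩
  f 0 * f (suc L) * ∏ L (f ∘ suc)  ≤⟨ *-mono-≤ ends middle ⟩
  g 0 * g (suc L) * ∏ L (g ∘ suc)  ≡⟨ ∏-ends L g ⟨
  ∏ (suc (suc L)) g                ∎
  where
  open ≤-Reasoning
  f g : ℕ → ℕ
  f t = C t + (s + (suc (suc L) ∸ suc t)) * K t
  g t = C t + (s + t) * K t
  ends : f 0 * f (suc L) ≤ g 0 * g (suc L)
  ends = ≡.subst (λ z → (C 0 + (s + suc L) * K 0) * (C (suc L) + (s + z) * K (suc L)) ≤ g 0 * g (suc L))
           (≡.sym (n∸n≡0 L))
           (exchange-≤ (C 0) (C (suc L)) (K 0) (K (suc L)) (+-monoʳ-≤ s z≤n) (cross z≤n ≤-refl))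
  shift : ∀ t → t < L → f (suc t) ≡ C (suc t) + (suc s + (L ∸ suc t)) * K (suc t)
  shift t t<L = cong (λ w → C (suc t) + w * K (suc t))
                     (≡.trans (cong (s +_) (+-∸-assoc 1 t<L)) (+-suc s (L ∸ suc t)))
  middle : ∏ L (f ∘ suc) ≤ ∏ L (g ∘ suc)
  middle = begin
    ∏ L (f ∘ suc)                                             ≡⟨ ∏-cong L shift ⟩
    ∏ L (λ t → C (suc t) + (suc s + (L ∸ suc t)) * K (suc t))
      ≤⟨ rearrangement L (suc s) (C ∘ suc) (K ∘ suc) (λ a≤b b<L → cross (s≤s a≤b) (s≤s (m≤n⇒m≤1+n b<L))) ⟩
    ∏ L (λ t → C (suc t) + (suc s + t) * K (suc t))
      ≡⟨ ∏-cong L (λ t _ → cong (λ w → C (suc t) + w * K (suc t)) (+-suc s t)) ⟨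
    ∏ L (g ∘ suc)                                             ∎

-- m is a segment [0, T), on which the numbers T ∸ suc i of points above i are the coordinates in reverse.
lineSweep : ∀ n {m} → DownClosed m → BoundedBy n m → (C K : ℕ → ℕ) →
  (∀ {a b} → a ≤ b → m b ≡ true → K a * C b ≤ C a * K b) →
  ∏ n (λ i → if m i then C i + ∑ n (λ p → ⟦ m p ⟧ * χ above (side p i)) * K i else 1)
    ≤ ∏ n (λ i → if m i then C i + i * K i else 1)
lineSweep n {m} lower bounded C K cross with downClosed⇒prefix n lower bounded
... | T , T≤n , m⇒<T , <T⇒m = begin
  ∏ n (λ i → if m i then C i + up i * K i else 1)  ≡⟨ ∏-restrict n _ T≤n m⇒<T <T⇒m ⟩
  ∏ T (λ i → C i + up i * K i)                     ≡⟨ ∏-cong T (λ i _ → cong (λ w → C i + w * K i) (up≡ i)) ⟩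
  ∏ T (λ i → C i + (T ∸ suc i) * K i)                 ≤⟨ rearrangement T 0 C K (λ a≤b b<T → cross a≤b (<T⇒m _ b<T)) ⟩
  ∏ T (λ i → C i + i * K i)                           ≡⟨ ∏-restrict n _ T≤n m⇒<T <T⇒m ⟨
  ∏ n (λ i → if m i then C i + i * K i else 1)        ∎
  where
  open ≤-Reasoning
  up : ℕ → ℕ
  up i = ∑ n (λ p → ⟦ m p ⟧ * χ above (side p i))
  up≡ : ∀ i → up i ≡ T ∸ suc i
  up≡ i = ≡.trans (∑-cong n (λ p _ → ⟦⟧-* (m p) _))
               (≡.trans (∑-restrict n _ T≤n m⇒<T <T⇒m) (∑-above T i))

-- Lower sets in a box

record SymmetricAffine : Set where
  field
    C K          : ℕ → ℕ → ℕ
    C/K-monotone : ∀ {b c b′ c′} → b′ ≤ b → c′ ≤ c → K b c * C b′ c′ ≤ C b c * K b′ c′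
    swap₁₂       : ∀ a b c → C b c + a * K b c ≡ C a c + b * K a c
    swap₁₃       : ∀ a b c → C b c + a * K b c ≡ C a b + c * K a b

  H : ℕ → ℕ → ℕ → ℕ
  H a b c = C b c + a * K b c

oneStepForm : SymmetricAffine
oneStepForm = record
  { C = λ b c → suc (b + c) ; K = λ _ _ → 1
  ; C/K-monotone = λ b′≤b c′≤c → ≤-trans (≤-reflexive (+-identityʳ _))
                                   (≤-trans (s≤s (+-mono-≤ b′≤b c′≤c)) (≤-reflexive (≡.sym (*-identityʳ _))))
  ; swap₁₂ = solve-∀ ; swap₁₃ = solve-∀ }

twoStepForm : SymmetricAffine
twoStepForm = record
  { C = λ b c → suc b * suc c ; K = λ b c → suc (b + c)
  ; C/K-monotone = monotone ; swap₁₂ = solve-∀ ; swap₁₃ = solve-∀ }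
  where
  expand : ∀ b′ c′ x y → suc ((b′ + x) + (c′ + y)) * (suc b′ * suc c′) + (y * suc (b′ + x) * b′ + x * suc c′ * (c′ + y))
                         ≡ suc (b′ + x) * suc (c′ + y) * suc (b′ + c′)
  expand = solve-∀
  monotone : ∀ {b c b′ c′} → b′ ≤ b → c′ ≤ c → suc (b + c) * (suc b′ * suc c′) ≤ suc b * suc c * suc (b′ + c′)
  monotone {b′ = b′} {c′} b′≤b c′≤c with m≤n⇒∃[o]m+o≡n b′≤b | m≤n⇒∃[o]m+o≡n c′≤c
  ... | x , refl | y , refl =
    ≤-trans (m≤m+n _ (y * suc (b′ + x) * b′ + x * suc c′ * (c′ + y))) (≤-reflexive (expand b′ c′ x y))

oneStepForm-H : ∀ a b c → SymmetricAffine.H oneStepForm a b c ≡ 1 + a + b + c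
oneStepForm-H = expand
  where
  expand : ∀ a b c → suc (b + c) + a * 1 ≡ 1 + a + b + c
  expand = solve-∀

twoStepForm-H : ∀ a b c → SymmetricAffine.H twoStepForm a b c ≡ 1 + a + b + c + a * b + a * c + b * c
twoStepForm-H = expand
  where
  expand : ∀ a b c → suc b * suc c + a * suc (b + c) ≡ 1 + a + b + c + a * b + a * c + b * c
  expand = solve-∀

module BoxIdeal (n : ℕ) (M : ℕ → ℕ → ℕ → Bool)
  (M-lower : ∀ {p q r p′ q′ r′} → M p q r ≡ true → p′ ≤ p → q′ ≤ q → r′ ≤ r → M p′ q′ r′ ≡ true)
  (M-bounded : ∀ {p q r} → M p q r ≡ true → p < n × q < n × r < n) where

  ∏∈ : (ℕ → ℕ → ℕ → ℕ) → ℕ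
  ∏∈ f = ∏³ n λ i j k → if M i j k then f i j k else 1

  arm₁ arm₂ arm₃ : ℕ → ℕ → ℕ → ℕ
  arm₁ i j k = ∑ n λ p → ⟦ M p j k ⟧ * χ above (side p i)
  arm₂ i j k = ∑ n λ q → ⟦ M i q k ⟧ * χ above (side q j)
  arm₃ i j k = ∑ n λ r → ⟦ M i j r ⟧ * χ above (side r k)

  arm₂-antitone₁ : ∀ {i i′ j k} → i ≤ i′ → arm₂ i′ j k ≤ arm₂ i j k
  arm₂-antitone₁ i≤i′ = ∑-mono-≤ n λ q _ → *-monoˡ-≤ _ (⟦⟧-mono λ m → M-lower m i≤i′ ≤-refl ≤-refl)

  arm₃-antitone₁ : ∀ {i i′ j k} → i ≤ i′ → arm₃ i′ j k ≤ arm₃ i j k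
  arm₃-antitone₁ i≤i′ = ∑-mono-≤ n λ r _ → *-monoˡ-≤ _ (⟦⟧-mono λ m → M-lower m i≤i′ ≤-refl ≤-refl)

  arm₃-antitone₂ : ∀ {i j j′ k} → j ≤ j′ → arm₃ i j′ k ≤ arm₃ i j k
  arm₃-antitone₂ j≤j′ = ∑-mono-≤ n λ r _ → *-monoˡ-≤ _ (⟦⟧-mono λ m → M-lower m ≤-refl j≤j′ ≤-refl)

  ∏∈-cong : {f g : ℕ → ℕ → ℕ → ℕ} → (∀ i j k → f i j k ≡ g i j k) → ∏∈ f ≡ ∏∈ g
  ∏∈-cong f≡g = ∏³-cong n λ i j k → cong (if M i j k then_else 1) (f≡g i j k)

  ∏∈-mono-≤ : {f g : ℕ → ℕ → ℕ → ℕ} → (∀ {i j k} → M i j k ≡ true → f i j k ≤ g i j k) → ∏∈ f ≤ ∏∈ g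
  ∏∈-mono-≤ {f} {g} f≤g = ∏-mono-≤ n λ k _ → ∏-mono-≤ n λ j _ → ∏-mono-≤ n λ i _ → pointwise i j k
    where
    pointwise : ∀ i j k → (if M i j k then f i j k else 1) ≤ (if M i j k then g i j k else 1)
    pointwise i j k with M i j k in m
    ... | true  = f≤g m
    ... | false = ≤-refl

  ∏∈-j-innermost : ∀ f → ∏∈ f ≡ ∏ n λ k → ∏ n λ i → ∏ n λ j → if M i j k then f i j k else 1
  ∏∈-j-innermost f = ∏-cong n λ k _ → ∏-comm n n λ j i → if M i j k then f i j k else 1

  ∏∈-k-innermost : ∀ f → ∏∈ f ≡ ∏ n λ i → ∏ n λ j → ∏ n λ k → if M i j k then f i j k else 1
  ∏∈-k-innermost f = ≡.trans (∏∈-j-innermost f) (≡.trans (∏-comm n n _) (∏-cong n λ i _ → ∏-comm n n _))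

  sweep₁ : (C K : ℕ → ℕ → ℕ → ℕ) →
    (∀ {i i′ j k} → i ≤ i′ → M i′ j k ≡ true → K i j k * C i′ j k ≤ C i j k * K i′ j k) →
    ∏∈ (λ i j k → C i j k + arm₁ i j k * K i j k) ≤ ∏∈ (λ i j k → C i j k + i * K i j k)
  sweep₁ C K cross = ∏-mono-≤ n λ k _ → ∏-mono-≤ n λ j _ →
    lineSweep n (λ a≤b m → M-lower m a≤b ≤-refl ≤-refl) (λ _ m → proj₁ (M-bounded m))
      (λ i → C i j k) (λ i → K i j k) cross

  sweep₂ : (C K : ℕ → ℕ → ℕ → ℕ) →
    (∀ {i j j′ k} → j ≤ j′ → M i j′ k ≡ true → K i j k * C i j′ k ≤ C i j k * K i j′ k) →
    ∏∈ (λ i j k → C i j k + arm₂ i j k * K i j k) ≤ ∏∈ (λ i j k → C i j k + j * K i j k)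
  sweep₂ C K cross = begin
    ∏∈ (λ i j k → C i j k + arm₂ i j k * K i j k)  ≡⟨ ∏∈-j-innermost _ ⟩
    _                                             ≤⟨ (∏-mono-≤ n λ k _ → ∏-mono-≤ n λ i _ →
                                                       lineSweep n (λ a≤b m → M-lower m ≤-refl a≤b ≤-refl)
                                                         (λ _ m → proj₁ (proj₂ (M-bounded m)))
                                                         (λ j → C i j k) (λ j → K i j k) cross) ⟩
    _                                             ≡⟨ ∏∈-j-innermost _ ⟨
    ∏∈ (λ i j k → C i j k + j * K i j k)           ∎
    where open ≤-Reasoning

  sweep₃ : (C K : ℕ → ℕ → ℕ → ℕ) →
    (∀ {i j k k′} → k ≤ k′ → M i j k′ ≡ true → K i j k * C i j k′ ≤ C i j k * K i j k′) →
    ∏∈ (λ i j k → C i j k + arm₃ i j k * K i j k) ≤ ∏∈ (λ i j k → C i j k + k * K i j k)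
  sweep₃ C K cross = begin
    ∏∈ (λ i j k → C i j k + arm₃ i j k * K i j k)  ≡⟨ ∏∈-k-innermost _ ⟩
    _                                             ≤⟨ (∏-mono-≤ n λ i _ → ∏-mono-≤ n λ j _ →
                                                       lineSweep n (λ a≤b m → M-lower m ≤-refl ≤-refl a≤b)
                                                         (λ _ m → proj₂ (proj₂ (M-bounded m)))
                                                         (λ k → C i j k) (λ k → K i j k) cross) ⟩
    _                                             ≡⟨ ∏∈-k-innermost _ ⟨
    ∏∈ (λ i j k → C i j k + k * K i j k)           ∎
    where open ≤-Reasoning

  ∏∈-arms≤∏∈-coords : (S : SymmetricAffine) → let open SymmetricAffine S in
    ∏∈ (λ i j k → H (arm₁ i j k) (arm₂ i j k) (arm₃ i j k)) ≤ ∏∈ H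
  ∏∈-arms≤∏∈-coords S = begin
    ∏∈ (λ i j k → H (arm₁ i j k) (arm₂ i j k) (arm₃ i j k))
      ≤⟨ sweep₁ (λ i j k → C (arm₂ i j k) (arm₃ i j k)) (λ i j k → K (arm₂ i j k) (arm₃ i j k))
                (λ i≤i′ _ → C/K-monotone (arm₂-antitone₁ i≤i′) (arm₃-antitone₁ i≤i′)) ⟩
    ∏∈ (λ i j k → H i (arm₂ i j k) (arm₃ i j k))
      ≡⟨ ∏∈-cong (λ i j k → swap₁₂ i (arm₂ i j k) (arm₃ i j k)) ⟩
    ∏∈ (λ i j k → C i (arm₃ i j k) + arm₂ i j k * K i (arm₃ i j k))
      ≤⟨ sweep₂ (λ i j k → C i (arm₃ i j k)) (λ i j k → K i (arm₃ i j k))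
                (λ j≤j′ _ → C/K-monotone ≤-refl (arm₃-antitone₂ j≤j′)) ⟩
    ∏∈ (λ i j k → C i (arm₃ i j k) + j * K i (arm₃ i j k))
      ≡⟨ ∏∈-cong (λ i j k → ≡.trans (≡.sym (swap₁₂ i j (arm₃ i j k))) (swap₁₃ i j (arm₃ i j k))) ⟩
    ∏∈ (λ i j k → C i j + arm₃ i j k * K i j)
      ≤⟨ sweep₃ (λ i j k → C i j) (λ i j k → K i j) (λ {i} {j} _ _ → ≤-reflexive (*-comm (K i j) (C i j))) ⟩
    ∏∈ (λ i j k → C i j + k * K i j)
      ≡⟨ ∏∈-cong (λ i j k → ≡.sym (swap₁₃ i j k)) ⟩
    ∏∈ H ∎
    where
    open ≤-Reasoning
    open SymmetricAffine S

  ∑∈ : (ℕ → ℕ → ℕ → ℕ) → ℕ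
  ∑∈ g = ∑³ n λ p q r → ⟦ M p q r ⟧ * g p q r

  cellCount : (Side → Side → Side → ℕ) → ℕ → ℕ → ℕ → ℕ
  cellCount c i j k = ∑∈ λ p q r → c (side p i) (side q j) (side r k)

  module AtPoint {i j k : ℕ} (Mijk : M i j k ≡ true) where

    i<n : i < n
    i<n = proj₁ (M-bounded Mijk)
    j<n : j < n
    j<n = proj₁ (proj₂ (M-bounded Mijk))
    k<n : k < n
    k<n = proj₂ (proj₂ (M-bounded Mijk))

    line₁ line₂ line₃ plane₁₂ plane₁₃ plane₂₃ : Side → ℕ
    line₁ t = ∑ n λ p → ⟦ M p j k ⟧ * χ t (side p i)
    line₂ t = ∑ n λ q → ⟦ M i q k ⟧ * χ t (side q j)
    line₃ t = ∑ n λ r → ⟦ M i j r ⟧ * χ t (side r k)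
    plane₁₂ t = ∑ n λ q → ∑ n λ p → ⟦ M p q k ⟧ * (χ t (side p i) * χ t (side q j))
    plane₁₃ t = ∑ n λ r → ∑ n λ p → ⟦ M p j r ⟧ * (χ t (side p i) * χ t (side r k))
    plane₂₃ t = ∑ n λ r → ∑ n λ q → ⟦ M i q r ⟧ * (χ t (side q j) * χ t (side r k))

    cell : Side → Side → Side → ℕ → ℕ → ℕ → ℕ
    cell u v w p q r = χ u (side p i) * χ v (side q j) * χ w (side r k)

    ∑∈-+ : (F G : ℕ → ℕ → ℕ → ℕ) → ∑∈ (λ p q r → F p q r + G p q r) ≡ ∑∈ F + ∑∈ G
    ∑∈-+ F G = ≡.trans (∑³-cong n λ p q r → *-distribˡ-+ ⟦ M p q r ⟧ (F p q r) (G p q r)) (∑³-distrib n _ _)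

    ∑∈-point : ∑∈ (cell level level level) ≡ 1
    ∑∈-point = begin
      ∑∈ (cell level level level)
        ≡⟨ ∑³-cong n (λ p q r → shape ⟦ M p q r ⟧ (χ level (side p i)) (χ level (side q j)) (χ level (side r k))) ⟩
      ∑³ n (λ p q r → χ level (side p i) * (χ level (side q j) * (χ level (side r k) * ⟦ M p q r ⟧)))
        ≡⟨ ∑³-pick₁₂ n i<n j<n k<n (λ p q r → χ level (side r k) * ⟦ M p q r ⟧) ⟩
      ∑ n (λ r → χ level (side r k) * ⟦ M i j r ⟧)
        ≡⟨ ∑-pick n (λ r → ⟦ M i j r ⟧) k<n ⟩
      ⟦ M i j k ⟧
        ≡⟨ cong ⟦_⟧ Mijk ⟩
      1 ∎
      where
      open ≡.≡-Reasoning
      shape : ∀ m a b c → m * (a * b * c) ≡ a * (b * (c * m))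
      shape = solve-∀

    ∑∈-line₁ : ∀ t → ∑∈ (cell t level level) ≡ line₁ t
    ∑∈-line₁ t = ≡.trans (∑³-cong n λ p q r → shape ⟦ M p q r ⟧ (χ t (side p i)) (χ level (side q j)) (χ level (side r k)))
                         (∑³-pick₂₃ n i<n j<n k<n λ p q r → ⟦ M p q r ⟧ * χ t (side p i))
      where
      shape : ∀ m a b c → m * (a * b * c) ≡ b * (c * (m * a))
      shape = solve-∀

    ∑∈-line₂ : ∀ t → ∑∈ (cell level t level) ≡ line₂ t
    ∑∈-line₂ t = ≡.trans (∑³-cong n λ p q r → shape ⟦ M p q r ⟧ (χ level (side p i)) (χ t (side q j)) (χ level (side r k)))
                         (∑³-pick₁₃ n i<n j<n k<n λ p q r → ⟦ M p q r ⟧ * χ t (side q j))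
      where
      shape : ∀ m a b c → m * (a * b * c) ≡ a * (c * (m * b))
      shape = solve-∀

    ∑∈-line₃ : ∀ t → ∑∈ (cell level level t) ≡ line₃ t
    ∑∈-line₃ t = ≡.trans (∑³-cong n λ p q r → shape ⟦ M p q r ⟧ (χ level (side p i)) (χ level (side q j)) (χ t (side r k)))
                         (∑³-pick₁₂ n i<n j<n k<n λ p q r → ⟦ M p q r ⟧ * χ t (side r k))
      where
      shape : ∀ m a b c → m * (a * b * c) ≡ a * (b * (m * c))
      shape = solve-∀

    ∑∈-plane₁₂ : ∀ t → ∑∈ (cell t t level) ≡ plane₁₂ t
    ∑∈-plane₁₂ t = ≡.trans (∑³-cong n λ p q r → shape ⟦ M p q r ⟧ (χ t (side p i)) (χ t (side q j)) (χ level (side r k)))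
                           (∑³-pick₃ n i<n j<n k<n λ p q r → ⟦ M p q r ⟧ * (χ t (side p i) * χ t (side q j)))
      where
      shape : ∀ m a b c → m * (a * b * c) ≡ c * (m * (a * b))
      shape = solve-∀

    ∑∈-plane₁₃ : ∀ t → ∑∈ (cell t level t) ≡ plane₁₃ t
    ∑∈-plane₁₃ t = ≡.trans (∑³-cong n λ p q r → shape ⟦ M p q r ⟧ (χ t (side p i)) (χ level (side q j)) (χ t (side r k)))
                           (∑³-pick₂ n i<n j<n k<n λ p q r → ⟦ M p q r ⟧ * (χ t (side p i) * χ t (side r k)))
      where
      shape : ∀ m a b c → m * (a * b * c) ≡ b * (m * (a * c))
      shape = solve-∀

    ∑∈-plane₂₃ : ∀ t → ∑∈ (cell level t t) ≡ plane₂₃ t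
    ∑∈-plane₂₃ t = ≡.trans (∑³-cong n λ p q r → shape ⟦ M p q r ⟧ (χ level (side p i)) (χ t (side q j)) (χ t (side r k)))
                           (∑³-pick₁ n i<n j<n k<n λ p q r → ⟦ M p q r ⟧ * (χ t (side q j) * χ t (side r k)))
      where
      shape : ∀ m a b c → m * (a * b * c) ≡ a * (m * (b * c))
      shape = solve-∀

    ∑∈-+₄ : (A B C D : ℕ → ℕ → ℕ → ℕ) →
      ∑∈ (λ p q r → A p q r + B p q r + C p q r + D p q r) ≡ ∑∈ A + ∑∈ B + ∑∈ C + ∑∈ D
    ∑∈-+₄ A B C D = ≡.trans (∑∈-+ _ D) (cong (_+ ∑∈ D) (≡.trans (∑∈-+ _ C) (cong (_+ ∑∈ C) (∑∈-+ A B))))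

    ∑∈-oneStep : ∀ t → cellCount (oneStep t) i j k ≡ 1 + line₁ t + line₂ t + line₃ t
    ∑∈-oneStep t = ≡.trans (∑∈-+₄ (cell level level level) (cell t level level) (cell level t level) (cell level level t))
      (cong₂ _+_ (cong₂ _+_ (cong₂ _+_ ∑∈-point (∑∈-line₁ t)) (∑∈-line₂ t)) (∑∈-line₃ t))

    ∑∈-twoStep : ∀ t → cellCount (twoStep t) i j k
                       ≡ 1 + line₁ t + line₂ t + line₃ t + plane₁₂ t + plane₁₃ t + plane₂₃ t
    ∑∈-twoStep t = ≡.trans (∑∈-+₄ (λ p q r → oneStep t (side p i) (side q j) (side r k))
                                  (cell t t level) (cell t level t) (cell level t t))
      (cong₂ _+_ (cong₂ _+_ (cong₂ _+_ (∑∈-oneStep t) (∑∈-plane₁₂ t)) (∑∈-plane₁₃ t)) (∑∈-plane₂₃ t))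

    line₁-below : line₁ below ≡ i
    line₁-below = ∑-below-within n (λ a≤b m → M-lower m a≤b ≤-refl ≤-refl) Mijk (<⇒≤ i<n)

    line₂-below : line₂ below ≡ j
    line₂-below = ∑-below-within n (λ a≤b m → M-lower m ≤-refl a≤b ≤-refl) Mijk (<⇒≤ j<n)

    line₃-below : line₃ below ≡ k
    line₃-below = ∑-below-within n (λ a≤b m → M-lower m ≤-refl ≤-refl a≤b) Mijk (<⇒≤ k<n)

    plane₁₂-below : plane₁₂ below ≡ i * j
    plane₁₂-below = ∑²-below-within n (λ a′≤a b′≤b m → M-lower m a′≤a b′≤b ≤-refl) Mijk (<⇒≤ i<n) (<⇒≤ j<n)

    plane₁₃-below : plane₁₃ below ≡ i * k
    plane₁₃-below = ∑²-below-within n (λ a′≤a b′≤b m → M-lower m a′≤a ≤-refl b′≤b) Mijk (<⇒≤ i<n) (<⇒≤ k<n)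

    plane₂₃-below : plane₂₃ below ≡ j * k
    plane₂₃-below = ∑²-below-within n (λ a′≤a b′≤b m → M-lower m ≤-refl a′≤a b′≤b) Mijk (<⇒≤ j<n) (<⇒≤ k<n)

    plane₁₂-above : plane₁₂ above ≤ arm₁ i j k * arm₂ i j k
    plane₁₂-above = ∑²-above-≤ n i j (λ a′≤a b′≤b m → M-lower m a′≤a b′≤b ≤-refl)

    plane₁₃-above : plane₁₃ above ≤ arm₁ i j k * arm₃ i j k
    plane₁₃-above = ∑²-above-≤ n i k (λ a′≤a b′≤b m → M-lower m a′≤a ≤-refl b′≤b)

    plane₂₃-above : plane₂₃ above ≤ arm₂ i j k * arm₃ i j k
    plane₂₃-above = ∑²-above-≤ n j k (λ a′≤a b′≤b m → M-lower m ≤-refl a′≤a b′≤b)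

    oneStep-above : cellCount (oneStep above) i j k ≡ 1 + arm₁ i j k + arm₂ i j k + arm₃ i j k
    oneStep-above = ∑∈-oneStep above

    oneStep-below : cellCount (oneStep below) i j k ≡ 1 + i + j + k
    oneStep-below = ≡.trans (∑∈-oneStep below)
      (cong₂ _+_ (cong₂ _+_ (cong (1 +_) line₁-below) line₂-below) line₃-below)

    twoStep-above : cellCount (twoStep above) i j k ≤ 1 + arm₁ i j k + arm₂ i j k + arm₃ i j k
                      + arm₁ i j k * arm₂ i j k + arm₁ i j k * arm₃ i j k + arm₂ i j k * arm₃ i j k
    twoStep-above = ≤-trans (≤-reflexive (∑∈-twoStep above))
      (+-mono-≤ (+-mono-≤ (+-monoʳ-≤ (1 + arm₁ i j k + arm₂ i j k + arm₃ i j k) plane₁₂-above)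
                          plane₁₃-above) plane₂₃-above)

    twoStep-below : cellCount (twoStep below) i j k ≡ 1 + i + j + k + i * j + i * k + j * k
    twoStep-below = ≡.trans (∑∈-twoStep below)
      (cong₂ _+_ (cong₂ _+_ (cong₂ _+_ (cong₂ _+_ (cong₂ _+_ (cong (1 +_) line₁-below) line₂-below) line₃-below)
                                        plane₁₂-below) plane₁₃-below) plane₂₃-below)

  ∏∈-cellCount-≤ : (S : SymmetricAffine) (c↑ c↓ : Side → Side → Side → ℕ) → let open SymmetricAffine S in
    (∀ {i j k} → M i j k ≡ true → cellCount c↑ i j k ≤ H (arm₁ i j k) (arm₂ i j k) (arm₃ i j k)) →
    (∀ {i j k} → M i j k ≡ true → H i j k ≤ cellCount c↓ i j k) →
    ∏∈ (cellCount c↑) ≤ ∏∈ (cellCount c↓)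
  ∏∈-cellCount-≤ S c↑ c↓ ≤H H≤ = ≤-trans (∏∈-mono-≤ ≤H) (≤-trans (∏∈-arms≤∏∈-coords S) (∏∈-mono-≤ H≤))

  ∏∈-oneStep-≤ : ∏∈ (cellCount (oneStep above)) ≤ ∏∈ (cellCount (oneStep below))
  ∏∈-oneStep-≤ = ∏∈-cellCount-≤ oneStepForm (oneStep above) (oneStep below)
    (λ {i} {j} {k} Mijk → ≤-reflexive (≡.trans (AtPoint.oneStep-above Mijk)
                                              (≡.sym (oneStepForm-H (arm₁ i j k) (arm₂ i j k) (arm₃ i j k)))))
    (λ {i} {j} {k} Mijk → ≤-reflexive (≡.trans (oneStepForm-H i j k) (≡.sym (AtPoint.oneStep-below Mijk))))

  ∏∈-twoStep-≤ : ∏∈ (cellCount (twoStep above)) ≤ ∏∈ (cellCount (twoStep below))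
  ∏∈-twoStep-≤ = ∏∈-cellCount-≤ twoStepForm (twoStep above) (twoStep below)
    (λ {i} {j} {k} Mijk → ≤-trans (AtPoint.twoStep-above Mijk)
                                  (≤-reflexive (≡.sym (twoStepForm-H (arm₁ i j k) (arm₂ i j k) (arm₃ i j k)))))
    (λ {i} {j} {k} Mijk → ≤-reflexive (≡.trans (twoStepForm-H i j k) (≡.sym (AtPoint.twoStep-below Mijk))))

-- From solid partitions to lower sets in a box

does⇒ : ∀ {A : Set} (a? : Dec A) → does a? ≡ true → A
does⇒ (yes a) _ = a

length-filter≡sum : ∀ {P : Pred Pt 0ℓ} (P? : Decidable P) xs →
  length (filter P? xs) ≡ sum (map (λ x → ⟦ does (P? x) ⟧) xs)
length-filter≡sum P? []       = refl
length-filter≡sum P? (x ∷ xs) with does (P? x)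
... | true  = cong suc (length-filter≡sum P? xs)
... | false = length-filter≡sum P? xs

size : Pt → ℕ
size (i , j , k) = suc (i + j + k)

inBox-size : ∀ x → InBox (size x) x
inBox-size (i , j , k) = s≤s (≤-trans (m≤m+n i j) (m≤m+n (i + j) k)) ,
                         s≤s (≤-trans (m≤n+m j i) (m≤m+n (i + j) k)) ,
                         s≤s (m≤n+m k (i + j))

inBox-mono : ∀ {m n x} → m ≤ n → InBox m x → InBox n x
inBox-mono m≤n (i<m , j<m , k<m) = ≤-trans i<m m≤n , ≤-trans j<m m≤n , ≤-trans k<m m≤n

boxSize : List Pt → ℕ
boxSize xs = sum (map size xs)

∈⇒size≤boxSize : ∀ {x xs} → x ∈ xs → size x ≤ boxSize xs
∈⇒size≤boxSize {xs = y ∷ ys} (here refl) = m≤m+n (size y) (boxSize ys)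
∈⇒size≤boxSize {xs = y ∷ ys} (there x∈) = ≤-trans (∈⇒size≤boxSize x∈) (m≤n+m (boxSize ys) (size y))

module SolidPartitionBox (Λ : SolidPartition) where

  n : ℕ
  n = boxSize (elems Λ)

  M : ℕ → ℕ → ℕ → Bool
  M p q r = does ((p , q , r) ∈? elems Λ)

  inBox : ∀ {x} → x ∈ elems Λ → InBox n x
  inBox {x} x∈Λ = inBox-mono (∈⇒size≤boxSize x∈Λ) (inBox-size x)

  M-lower : ∀ {p q r p′ q′ r′} → M p q r ≡ true → p′ ≤ p → q′ ≤ q → r′ ≤ r → M p′ q′ r′ ≡ true
  M-lower m p′≤p q′≤q r′≤r = dec-true (_ ∈? elems Λ) (lower Λ (does⇒ (_ ∈? elems Λ) m) p′≤p q′≤q r′≤r)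

  M-bounded : ∀ {p q r} → M p q r ≡ true → p < n × q < n × r < n
  M-bounded m = inBox (does⇒ (_ ∈? elems Λ) m)

  open BoxIdeal n M M-lower M-bounded public

  prodOver-count : ∀ {S : Pt → Pred Pt 0ℓ} (S? : ∀ x → Decidable (S x)) (cells : Side → Side → Side → ℕ) →
    (∀ i j k p q r → ⟦ does (S? (i , j , k) (p , q , r)) ⟧ ≡ cells (side p i) (side q j) (side r k)) →
    prodOver Λ (λ x → count Λ (S? x)) ≡ ∏∈ (cellCount cells)
  prodOver-count S? cells table =
    ≡.trans (∏-over-list n (unique Λ) inBox _) (∏∈-cong λ i j k → count≡ (i , j , k))
    where
    count≡ : ∀ (x@(i , j , k) : Pt) → count Λ (S? x) ≡ cellCount cells i j k
    count≡ x@(i , j , k) = begin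
      count Λ (S? x)                                                          ≡⟨ length-filter≡sum (S? x) (elems Λ) ⟩
      sum (map (λ y → ⟦ does (S? x y) ⟧) (elems Λ))                           ≡⟨ ∑-over-list n (unique Λ) inBox _ ⟩
      ∑³ n (λ p q r → if M p q r then ⟦ does (S? x (p , q , r)) ⟧ else 0)
        ≡⟨ ∑³-cong n (λ p q r → ≡.trans (≡.sym (⟦⟧-* (M p q r) _)) (cong (⟦ M p q r ⟧ *_) (table i j k p q r))) ⟩
      cellCount cells i j k                                                   ∎
      where open ≡.≡-Reasoning

corollary5p2 : (Λ : SolidPartition) →
    (prodOver Λ (R Λ) ≤ prodOver Λ (R* Λ)) × (prodOver Λ (Q Λ) ≤ prodOver Λ (Q* Λ))
corollary5p2 Λ =
  ≤-trans (≤-reflexive (prodOver-count RSet? (oneStep above) RSet-cells))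
    (≤-trans ∏∈-oneStep-≤ (≤-reflexive (≡.sym (prodOver-count R*Set? (oneStep below) R*Set-cells)))) ,
  ≤-trans (≤-reflexive (prodOver-count QSet? (twoStep above) QSet-cells))
    (≤-trans ∏∈-twoStep-≤ (≤-reflexive (≡.sym (prodOver-count Q*Set? (twoStep below) Q*Set-cells))))
  where open SolidPartitionBox Λ
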